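{- Let $C$ be the graph consisting of a single vertex $v$, and let $P$ be any graph with $r(P)\geq 2$. Then $A_{ucg}(C,P)=0$.
   Context: All graphs are finite and simple. $d(u,v)$ denotes the distance between vertices $u,v$ ($\infty$ if there is no path). The eccentricity of $v$ is $e(v)=\max_u d(u,v)$; the radius $r(G)$ is the minimum eccentricity and the diameter $\mathrm{diam}(G)$ the maximum eccentricity of vertices of $G$. For a graph $H$: the center $Z(H)$ is the set of vertices of minimum eccentricity; $EC(v)=\{x: d(v,x)=e(v)\}$; the centered periphery is $CP(H)=\bigcup_{z\in Z(H)} EC(z)$; $\langle S\rangle$ denotes the subgraph induced by a vertex set $S$. $H$ is a uniform central graph (UCG) if $EC(c)$ is the same set for all $c\in Z(H)$. The intermediate vertices are $I(H)=V(H)\setminus (Z(H)\cup CP(H))$. For graphs $C,P$, the central-peripheral appendage number $A_{ucg}(C,P)$ is the minimum of $|I(H)|$ over all UCGs $H$ with $\langle Z(H)\rangle\cong C$ and $\langle CP(H)\rangle\cong P$, and is $\infty$ if no such $H$ exists. -}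

module Defs where

open import Data.Nat using (ℕ; zero; suc; _≤_; _<_)
open import Data.Fin using (Fin)
open import Data.Bool using (Bool; true; false)
open import Data.Product using (Σ; _×_; _,_; ∃)
open import Data.Sum using (_⊎_)
open import Relation.Binary.PropositionalEquality using (_≡_)
open import Relation.Nullary using (¬_)
open import Function.Bundles using (_⇔_)
open import Function.Definitions using (Injective)

record Graph : Set where
  field
    n     : ℕ
    adj   : Fin n → Fin n → Bool
    sym   : ∀ u v → adj u v ≡ adj v u
    irref : ∀ u → adj u u ≡ false
open Graph public

Vtx : Graph → Set
Vtx G = Fin (n G)

data ℕ∞ : Set where
  fin : ℕ → ℕ∞
  ∞   : ℕ∞

data _≤∞_ : ℕ∞ → ℕ∞ → Set where
  fin≤fin : ∀ {a b} → a ≤ b → fin a ≤∞ fin b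
  ≤∞-top  : ∀ {a} → a ≤∞ ∞

Walk : (G : Graph) → ℕ → Vtx G → Vtx G → Set
Walk G zero    u v = u ≡ v
Walk G (suc k) u v = Σ (Vtx G) λ w → (adj G u w ≡ true) × Walk G k w v

IsDist : (G : Graph) → Vtx G → Vtx G → ℕ∞ → Set
IsDist G u v (fin k) = Walk G k u v × (∀ j → j < k → ¬ Walk G j u v)
IsDist G u v ∞       = ∀ j → ¬ Walk G j u v

IsEcc : (G : Graph) → Vtx G → ℕ∞ → Set
IsEcc G v e = (Σ (Vtx G) λ u → IsDist G u v e)
            × (∀ u d → IsDist G u v d → d ≤∞ e)

IsRadius : Graph → ℕ∞ → Set
IsRadius G r = (Σ (Vtx G) λ v → IsEcc G v r)
             × (∀ v e → IsEcc G v e → r ≤∞ e)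

InCenter : (G : Graph) → Vtx G → Set
InCenter G v = Σ ℕ∞ λ e → IsEcc G v e × (∀ u e' → IsEcc G u e' → e ≤∞ e')

InEC : (G : Graph) → Vtx G → Vtx G → Set
InEC G v x = Σ ℕ∞ λ e → IsEcc G v e × IsDist G v x e

InCP : (G : Graph) → Vtx G → Set
InCP G x = Σ (Vtx G) λ z → InCenter G z × InEC G z x

InI : (G : Graph) → Vtx G → Set
InI G x = ¬ (InCenter G x ⊎ InCP G x)

IsUCG : Graph → Set
IsUCG G = ∀ c c' → InCenter G c → InCenter G c' → ∀ x → (InEC G c x ⇔ InEC G c' x)

InducedIso : (G : Graph) → (Vtx G → Set) → Graph → Set
InducedIso G S C =
  Σ (Vtx C → Vtx G) λ φ →
      Injective _≡_ _≡_ φ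
    × (∀ x → (S x ⇔ (Σ (Vtx C) λ i → φ i ≡ x)))
    × (∀ i j → adj C i j ≡ adj G (φ i) (φ j))

HasCard : (G : Graph) → (Vtx G → Set) → ℕ → Set
HasCard G S k =
  Σ (Fin k → Vtx G) λ f →
      Injective _≡_ _≡_ f
    × (∀ x → (S x ⇔ (Σ (Fin k) λ i → f i ≡ x)))

Admissible : Graph → Graph → Graph → Set
Admissible C P H = IsUCG H × InducedIso H (InCenter H) C × InducedIso H (InCP H) P

AucgIs : Graph → Graph → ℕ → Set
AucgIs C P k =
    (Σ Graph λ H → Admissible C P H × HasCard H (InI H) k)
  × (∀ H m → Admissible C P H → HasCard H (InI H) m → k ≤ m)

K1 : Graph
K1 = record { n = 1 ; adj = λ _ _ → false ; sym = λ _ _ → refl' ; irref = λ _ → refl' }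
  where
    open import Relation.Binary.PropositionalEquality using () renaming (refl to refl')

module Submission where

open import Defs
open import Data.Bool using (Bool; true; false)
open import Data.Bool.Properties using (¬-not) renaming (_≟_ to _≟ᵇ_)
open import Data.Empty using (⊥-elim)
open import Data.Fin using (Fin) renaming (zero to fzero; suc to fsuc)
open import Data.Fin.Properties using (any?; ¬∀⟶∃¬; ¬Fin0; suc-injective; _≟_)
open import Data.Nat using (zero; suc; _≤_; _<_; z≤n; s≤s)
open import Data.Nat.Properties using (<-cmp; ≤-refl; ≤-trans)
open import Data.Product using (Σ; ∃; _×_; _,_)
open import Data.Sum using (_⊎_; inj₁; inj₂)
open import Function.Bundles using (_⇔_; mk⇔; Equivalence)
open import Relation.Binary using (tri<; tri≈; tri>)
open import Relation.Binary.PropositionalEquality using (_≡_; _≢_; refl; cong; trans; subst) renaming (sym to ≡-sym)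
open import Relation.Nullary using (¬_; yes; no)
open import Relation.Nullary.Decidable using (_⊎-dec_; ¬?)

-- Take H to be the cone over P: one new vertex joined to every vertex of P.
-- The apex has eccentricity 1. Since r(P) ≥ 2, no vertex of P dominates P,
-- so every vertex of P has a non-neighbour, at distance 2 in the cone; hence
-- the apex is the unique central vertex, its eccentric set is all of V(P),
-- and no vertex is intermediate.

≤∞-trans : ∀ {a b c} → a ≤∞ b → b ≤∞ c → a ≤∞ c
≤∞-trans (fin≤fin a≤b) (fin≤fin b≤c) = fin≤fin (≤-trans a≤b b≤c)
≤∞-trans _             ≤∞-top        = ≤∞-top

2≰∞1 : ¬ fin 2 ≤∞ fin 1
2≰∞1 (fin≤fin (s≤s ()))

module _ {G : Graph} where

  IsDist-unique : ∀ {u v d d′} → IsDist G u v d → IsDist G u v d′ → d ≡ d′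
  IsDist-unique {d = fin k} {fin k′} (w , min) (w′ , min′) with <-cmp k k′
  ... | tri< k<k′ _ _ = ⊥-elim (min′ k k<k′ w)
  ... | tri≈ _ k≡k′ _ = cong fin k≡k′
  ... | tri> _ _ k>k′ = ⊥-elim (min k′ k>k′ w′)
  IsDist-unique {d = fin k} {∞}     (w , _) none = ⊥-elim (none k w)
  IsDist-unique {d = ∞}     {fin k} none (w , _) = ⊥-elim (none k w)
  IsDist-unique {d = ∞}     {∞}     _ _          = refl

  IsDist-bound : ∀ {u v d k m} → IsDist G u v d → IsDist G u v (fin k) → k ≤ m → d ≤∞ fin m
  IsDist-bound D Dk k≤m = subst (_≤∞ _) (IsDist-unique Dk D) (fin≤fin k≤m)

  IsDist-refl : ∀ {u} → IsDist G u u (fin 0)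
  IsDist-refl = refl , λ _ ()

  IsDist-edge : ∀ {u v} → adj G u v ≡ true → IsDist G u v (fin 1)
  IsDist-edge {u} {v} uv = (v , uv , refl) , no-shorter-walk
    where
      no-shorter-walk : ∀ j → j < 1 → ¬ Walk G j u v
      no-shorter-walk zero _ refl with trans (≡-sym (irref G u)) uv
      ... | ()
      no-shorter-walk (suc _) (s≤s ()) _

Dominating : (G : Graph) → Vtx G → Set
Dominating G v = ∀ u → u ≡ v ⊎ adj G u v ≡ true

module _ {G : Graph} {v : Vtx G} where

  dominating-dist≤1 : Dominating G v → ∀ u d → IsDist G u v d → d ≤∞ fin 1
  dominating-dist≤1 dom u d D with dom u
  ... | inj₁ refl = IsDist-bound D IsDist-refl z≤n
  ... | inj₂ uv   = IsDist-bound D (IsDist-edge uv) ≤-refl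

  dominating-ecc≤1 : Dominating G v → ∃ λ e → IsEcc G v e × e ≤∞ fin 1
  dominating-ecc≤1 dom with any? (λ u → ¬? (u ≟ v))
  ... | yes (u , u≢v) = fin 1 , ((u , IsDist-edge (edge u u≢v)) , dominating-dist≤1 dom) , fin≤fin ≤-refl
    where
      edge : ∀ u → u ≢ v → adj G u v ≡ true
      edge u u≢v with dom u
      ... | inj₁ u≡v = ⊥-elim (u≢v u≡v)
      ... | inj₂ uv  = uv
  ... | no ∄u = fin 0 , ((v , IsDist-refl) , bound) , fin≤fin z≤n
    where
      bound : ∀ u d → IsDist G u v d → d ≤∞ fin 0
      bound u d D with u ≟ v
      ... | yes refl = IsDist-bound D IsDist-refl z≤n
      ... | no u≢v   = ⊥-elim (∄u (u , u≢v))

  radius≥2⇒¬dominating : ∀ {r} → IsRadius G r → fin 2 ≤∞ r → ¬ Dominating G v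
  radius≥2⇒¬dominating (_ , r-min) 2≤r dom with dominating-ecc≤1 dom
  ... | e , ecc , e≤1 = 2≰∞1 (≤∞-trans 2≤r (≤∞-trans (r-min v e ecc) e≤1))

  ¬dominating⇒non-neighbour : ¬ Dominating G v → ∃ λ u → u ≢ v × adj G u v ≡ false
  ¬dominating⇒non-neighbour ¬dom
    with ¬∀⟶∃¬ _ _ (λ u → (u ≟ v) ⊎-dec (adj G u v ≟ᵇ true)) ¬dom
  ... | u , ¬uv = u , (λ u≡v → ¬uv (inj₁ u≡v)) , ¬-not (λ uv → ¬uv (inj₂ uv))

module _ {G : Graph} where

  IsUCG-unique-center : ∀ {c} → (∀ x → InCenter G x → c ≡ x) → IsUCG G
  IsUCG-unique-center unique c c′ cZ c′Z x with unique c cZ | unique c′ c′Z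
  ... | refl | refl = mk⇔ (λ ec → ec) (λ ec → ec)

  InducedIso-K1 : ∀ {S c} → (∀ x → S x ⇔ c ≡ x) → InducedIso G S K1
  InducedIso-K1 {c = c} S⇔c =
      (λ _ → c)
    , (λ { {fzero} {fzero} _ → refl })
    , (λ x → mk⇔ (λ s → fzero , Equivalence.to (S⇔c x) s) (λ (_ , c≡x) → Equivalence.from (S⇔c x) c≡x))
    , (λ _ _ → ≡-sym (irref G c))

  HasCard-empty : ∀ {S} → (∀ x → ¬ S x) → HasCard G S 0
  HasCard-empty ∉S =
    (λ ()) , (λ {i} → ⊥-elim (¬Fin0 i)) , λ x → mk⇔ (λ s → ⊥-elim (∉S x s)) (λ (i , _) → ⊥-elim (¬Fin0 i))

cone : Graph → Graph
cone P = record { n = suc (n P) ; adj = cone-adj ; sym = cone-sym ; irref = cone-irref }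
  where
    cone-adj : Fin (suc (n P)) → Fin (suc (n P)) → Bool
    cone-adj fzero    fzero    = false
    cone-adj fzero    (fsuc _) = true
    cone-adj (fsuc _) fzero    = true
    cone-adj (fsuc i) (fsuc j) = adj P i j

    cone-sym : ∀ u v → cone-adj u v ≡ cone-adj v u
    cone-sym fzero    fzero    = refl
    cone-sym fzero    (fsuc _) = refl
    cone-sym (fsuc _) fzero    = refl
    cone-sym (fsuc i) (fsuc j) = sym P i j

    cone-irref : ∀ u → cone-adj u u ≡ false
    cone-irref fzero    = refl
    cone-irref (fsuc i) = irref P i

module _ (P : Graph) where

  apex : Vtx (cone P)
  apex = fzero

  apex-dominating : Dominating (cone P) apex
  apex-dominating fzero    = inj₁ refl
  apex-dominating (fsuc _) = inj₂ refl

  non-neighbours-dist : ∀ {i j} → j ≢ i → adj P j i ≡ false → IsDist (cone P) (fsuc j) (fsuc i) (fin 2)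
  non-neighbours-dist {i} {j} j≢i ji = (apex , refl , fsuc i , refl , refl) , no-shorter-walk
    where
      no-shorter-walk : ∀ k → k < 2 → ¬ Walk (cone P) k (fsuc j) (fsuc i)
      no-shorter-walk zero          _                 refl               = j≢i refl
      no-shorter-walk (suc zero)    _                 (fsuc _ , ji′ , refl) with trans (≡-sym ji) ji′
      ... | ()
      no-shorter-walk (suc (suc _)) (s≤s (s≤s ())) _

  apex-ecc : Vtx P → IsEcc (cone P) apex (fin 1)
  apex-ecc p = (fsuc p , IsDist-edge refl) , dominating-dist≤1 apex-dominating

  cone-ecc≥1 : Vtx P → ∀ u e → IsEcc (cone P) u e → fin 1 ≤∞ e
  cone-ecc≥1 p fzero    _ (_ , bound) = bound (fsuc p) (fin 1) (IsDist-edge refl)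
  cone-ecc≥1 _ (fsuc _) _ (_ , bound) = bound apex (fin 1) (IsDist-edge refl)

  apex-InCenter : Vtx P → InCenter (cone P) apex
  apex-InCenter p = fin 1 , apex-ecc p , cone-ecc≥1 p

  ¬dominating⇒base-∉center : ∀ {i} → ¬ Dominating P i → ¬ InCenter (cone P) (fsuc i)
  ¬dominating⇒base-∉center {i} ¬dom (e , (_ , bound) , e-min) with ¬dominating⇒non-neighbour {G = P} ¬dom
  ... | j , j≢i , ji =
    2≰∞1 (≤∞-trans (bound (fsuc j) (fin 2) (non-neighbours-dist j≢i ji)) (e-min apex (fin 1) (apex-ecc i)))

  module _ (p : Vtx P) (no-dom : ∀ i → ¬ Dominating P i) where

    cone-InCenter⇔apex : ∀ x → InCenter (cone P) x ⇔ apex ≡ x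
    cone-InCenter⇔apex fzero    = mk⇔ (λ _ → refl) (λ _ → apex-InCenter p)
    cone-InCenter⇔apex (fsuc i) = mk⇔ (λ iZ → ⊥-elim (¬dominating⇒base-∉center (no-dom i) iZ)) (λ ())

    apex-∉CP : ¬ InCP (cone P) apex
    apex-∉CP (z , zZ , e , ecc , D) with Equivalence.to (cone-InCenter⇔apex z) zZ
    ... | refl with cone-ecc≥1 p apex e ecc | IsDist-unique D IsDist-refl
    ...   | fin≤fin () | refl

    base-∈CP : ∀ i → InCP (cone P) (fsuc i)
    base-∈CP i = apex , apex-InCenter p , fin 1 , apex-ecc p , IsDist-edge refl

    cone-InCP⇔base : ∀ x → InCP (cone P) x ⇔ ∃ λ i → fsuc i ≡ x
    cone-InCP⇔base fzero    = mk⇔ (λ apexCP → ⊥-elim (apex-∉CP apexCP)) (λ ())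
    cone-InCP⇔base (fsuc i) = mk⇔ (λ _ → i , refl) (λ _ → base-∈CP i)

    cone-admissible : Admissible K1 P (cone P)
    cone-admissible =
        IsUCG-unique-center (λ x → Equivalence.to (cone-InCenter⇔apex x))
      , InducedIso-K1 {G = cone P} cone-InCenter⇔apex
      , (fsuc , suc-injective , cone-InCP⇔base , λ _ _ → refl)

    cone-∉I : ∀ x → ¬ InI (cone P) x
    cone-∉I fzero    ∉ZCP = ∉ZCP (inj₁ (apex-InCenter p))
    cone-∉I (fsuc i) ∉ZCP = ∉ZCP (inj₂ (base-∈CP i))

theorem6p1 : (P : Graph)
           → Σ ℕ∞ (λ r → IsRadius P r × fin 2 ≤∞ r)
           → AucgIs K1 P 0
theorem6p1 P (_ , rad@((p , _) , _) , 2≤r) =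
  (cone P , cone-admissible P p no-dom , HasCard-empty {G = cone P} (cone-∉I P p no-dom)) , λ _ _ _ _ → z≤n
  where
    no-dom : ∀ i → ¬ Dominating P i
    no-dom i = radius≥2⇒¬dominating {v = i} rad 2≤r
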